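{- Let $m\ge2$ and $k$ be positive integers. If $\sigma\in S_m$ is a connected permutation with $\ell_1(\sigma)=2k$, then $\sigma$ has at most $k+2-m$ cycles of length at least $2$.
   Context: $S_m$ is the group of permutations of $\{1,\dots,m\}$ in one-line notation. For $\pi\in S_a$, $\tau\in S_b$, the concatenation is $\pi+\tau=(\pi(1)\ldots\pi(a)\,(a+\tau(1))\ldots(a+\tau(b)))\in S_{a+b}$. A permutation is connected if it is not of the form $\pi+\tau$ with $\pi\in S_a,\tau\in S_b$, $a,b\ge1$. For $\sigma\in S_m$, $\ell_1(\sigma)=\sum_{i=1}^m|\sigma(i)-i|$. -}

module Defs where

open import Data.Nat using (ℕ; zero; suc; _+_; _≤_; _<_; _≥_)
open import Data.Nat.Properties using (_≤?_; _≟_)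
open import Data.Fin using (Fin; toℕ; _↑ˡ_; _↑ʳ_; cast)
open import Data.Fin.Permutation using (Permutation′; _⟨$⟩ʳ_)
open import Data.Nat.ListAction using (sum)
open import Data.List using (List; map; length; filter; allFin)
open import Data.Product using (Σ; _×_; ∃)
open import Data.Nat using (∣_-_∣)
open import Relation.Binary.PropositionalEquality using (_≡_; subst)
open import Relation.Nullary using (¬_; Dec; _×-dec_; ¬?)
open import Data.List.Relation.Unary.All using (All)
open import Data.List.Relation.Unary.All using () renaming (all? to All?)
open import Data.List using (upTo)

-- S_m : permutations of Fin m (0-indexed; i ↦ i+1 gives the paper's convention)
S : ℕ → Set
S m = Permutation′ m

val : ∀ {m} → S m → Fin m → ℕ
val σ i = toℕ (σ ⟨$⟩ʳ i)

dist : ℕ → ℕ → ℕ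
dist x y = ∣ x - y ∣

ℓ₁ : ∀ {m} → S m → ℕ
ℓ₁ {m} σ = sum (map (λ i → dist (val σ i) (toℕ i)) (allFin m))

IsConcat : ∀ {m a b} → (m ≡ a Data.Nat.+ b) → S m → S a → S b → Set
IsConcat {m} {a} {b} eq σ π τ =
  ((i : Fin a) → val σ (cast (Relation.Binary.PropositionalEquality.sym eq) (i ↑ˡ b)) ≡ toℕ (π ⟨$⟩ʳ i))
  × ((j : Fin b) → val σ (cast (Relation.Binary.PropositionalEquality.sym eq) (a ↑ʳ j)) ≡ a Data.Nat.+ toℕ (τ ⟨$⟩ʳ j))

Connected : ∀ {m} → S m → Set
Connected {m} σ =
  ¬ (Σ ℕ λ a → Σ ℕ λ b → 1 ≤ a × 1 ≤ b × Σ (m ≡ a Data.Nat.+ b) λ eq →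
       Σ (S a) λ π → Σ (S b) λ τ → IsConcat eq σ π τ)

iter : ∀ {m} → S m → ℕ → Fin m → Fin m
iter σ zero    i = i
iter σ (suc j) i = σ ⟨$⟩ʳ (iter σ j i)

-- i is the smallest element of its cycle and is not a fixed point;
-- such i are in bijection with the cycles of length ≥ 2.
-- (The cycle of i is {σ^j(i) : j < m}.)
IsCycleLeader : ∀ {m} → S m → Fin m → Set
IsCycleLeader {m} σ i =
  ¬ (val σ i ≡ toℕ i) × All (λ j → toℕ i ≤ toℕ (iter σ j i)) (upTo m)

isCycleLeader? : ∀ {m} (σ : S m) (i : Fin m) → Dec (IsCycleLeader σ i)
isCycleLeader? {m} σ i =
  ¬? (val σ i ≟ toℕ i) ×-dec All? (λ j → toℕ i ≤? toℕ (iter σ j i)) (upTo m)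

nontrivialCycles : ∀ {m} → S m → ℕ
nontrivialCycles {m} σ = length (filter (isCycleLeader? σ) (allFin m))

module Submission where

-- Since σ only permutes positions, Σ_i σ(i) = Σ_i i, so the upward displacement
-- up(σ) = Σ_i (σ(i) ∸ i) equals the downward one and ℓ₁(σ) = 2·up(σ); hence up(σ) = k.
-- Counting gap by gap, up(σ) = Σ_g crossings(g), where crossings(g) is the number of i
-- with i ≤ g < σ(i).  Connectivity means no initial segment {0,…,g} (g < m - 1) is
-- σ-invariant, so every inner gap is crossed at least once.  Every cycle of length ≥ 2 has a
-- least element L ("cycle leader") with σ(L) > L and σ⁻¹(L) > L; if L > 0, a position
-- crossing the gap below L must also cross the gap above L, so that gap is crossed twice.
-- Hence, for each gap g,
--     [g is a leader] + [g < m - 1]  ≤  [g = 0] + crossings(g),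
-- and summing gives c + (m - 1) ≤ 1 + k, i.e. c + m ≤ k + 2.

open import Defs
open import Data.Nat using (ℕ; zero; suc; pred; _+_; _*_; _∸_; _≤_; _<_; z≤n; s≤s)
open import Data.Nat.Properties
open import Data.Bool using (true; false; if_then_else_)
open import Data.Fin using (Fin; zero; suc; toℕ; fromℕ<)
import Data.Fin.Properties as Fin
open import Data.Fin.Permutation using (_⟨$⟩ʳ_; _⟨$⟩ˡ_; inverseˡ; inverseʳ; permutation)
open import Data.List using (map; length; filter; allFin; tabulate)
import Data.List.Properties as List
import Data.Nat.ListAction as List
open import Data.List.Membership.Propositional.Properties using (∈-upTo⁺)
import Data.List.Relation.Unary.All as All
open import Data.Product using (Σ; _×_; _,_; proj₁; proj₂)
open import Data.Sum using (inj₁; inj₂)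
open import Data.Empty using (⊥-elim)
open import Relation.Nullary using (Dec; yes; no; does; ¬_; _×-dec_; contradiction)
open import Relation.Nullary.Decidable using (dec-true; dec-false)
open import Relation.Unary using (Pred; Decidable)
open import Relation.Binary.PropositionalEquality
open import Algebra.Properties.CommutativeMonoid.Sum +-0-commutativeMonoid
  using (sum-syntax; sum-cong-≗; sum-replicate-zero; ∑-distrib-+; ∑-comm; ∑-permute)

sum-tabulate : ∀ {n} (f : Fin n → ℕ) → List.sum (tabulate f) ≡ ∑[ i < n ] f i
sum-tabulate {zero}  f = refl
sum-tabulate {suc n} f = cong (f zero +_) (sum-tabulate (λ i → f (suc i)))

∑-mono-≤ : ∀ {n} {f g : Fin n → ℕ} → (∀ i → f i ≤ g i) → ∑[ i < n ] f i ≤ ∑[ i < n ] g i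
∑-mono-≤ {zero}  f≤g = z≤n
∑-mono-≤ {suc n} f≤g = +-mono-≤ (f≤g zero) (∑-mono-≤ (λ i → f≤g (suc i)))

term≤∑ : ∀ {n} (f : Fin n → ℕ) i → f i ≤ ∑[ j < n ] f j
term≤∑ f zero    = m≤m+n _ _
term≤∑ f (suc i) = ≤-trans (term≤∑ (λ j → f (suc j)) i) (m≤n+m _ _)

two-terms≤∑ : ∀ {n} (f : Fin n → ℕ) {i j} → i ≢ j → f i + f j ≤ ∑[ k < n ] f k
two-terms≤∑ f {zero}  {zero}  i≢j = contradiction refl i≢j
two-terms≤∑ f {zero}  {suc j} i≢j = +-monoʳ-≤ (f zero) (term≤∑ (λ k → f (suc k)) j)
two-terms≤∑ f {suc i} {zero}  i≢j =
  subst (_≤ ∑[ k < _ ] f k) (+-comm (f zero) (f (suc i))) (two-terms≤∑ f {zero} {suc i} λ ())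
two-terms≤∑ f {suc i} {suc j} i≢j =
  ≤-trans (two-terms≤∑ (λ k → f (suc k)) (λ i≡j → i≢j (cong suc i≡j))) (m≤n+m _ _)

𝟙 : ∀ {p} {A : Set p} → Dec A → ℕ
𝟙 a? = if does a? then 1 else 0

𝟙-yes : ∀ {p} {A : Set p} (a? : Dec A) → A → 𝟙 a? ≡ 1
𝟙-yes a? a rewrite dec-true a? a = refl

𝟙-no : ∀ {p} {A : Set p} (a? : Dec A) → ¬ A → 𝟙 a? ≡ 0
𝟙-no a? ¬a rewrite dec-false a? ¬a = refl

𝟙-≤ : ∀ {p} {A : Set p} (a? : Dec A) {n} → (A → 1 ≤ n) → 𝟙 a? ≤ n
𝟙-≤ (yes a) 1≤n = 1≤n a
𝟙-≤ (no _)  1≤n = z≤n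

length-filter-tabulate : ∀ {n p} {P : Pred (Fin n) p} (P? : Decidable P) {k} (f : Fin k → Fin n) →
  length (filter P? (tabulate f)) ≡ ∑[ i < k ] 𝟙 (P? (f i))
length-filter-tabulate P? {zero}  f = refl
length-filter-tabulate P? {suc k} f with does (P? (f zero))
... | true  = cong suc (length-filter-tabulate P? (λ i → f (suc i)))
... | false = length-filter-tabulate P? (λ i → f (suc i))

inRange : ℕ → ℕ → ℕ → ℕ
inRange a b g = 𝟙 (a ≤? g ×-dec g <? b)

inRange-shift : ∀ a b g → inRange (suc a) (suc b) (suc g) ≡ inRange a b g
inRange-shift zero    b g = refl
inRange-shift (suc a) b g = refl

∑-inRange : ∀ n a b → b ≤ n → ∑[ g < n ] inRange a b (toℕ g) ≡ b ∸ a
∑-inRange n a zero _ = begin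
  ∑[ g < n ] inRange a 0 (toℕ g) ≡⟨ sum-cong-≗ {n} (λ g → 𝟙-no (a ≤? toℕ g ×-dec toℕ g <? 0) λ ()) ⟩
  ∑[ g < n ] 0                   ≡⟨ sum-replicate-zero n ⟩
  0                              ≡⟨ 0∸n≡0 a ⟨
  0 ∸ a                          ∎
  where open ≡-Reasoning
∑-inRange (suc n) zero    (suc b) (s≤s b≤n) = cong suc (∑-inRange n 0 b b≤n)
∑-inRange (suc n) (suc a) (suc b) (s≤s b≤n) =
  trans (sum-cong-≗ {n} (λ g → inRange-shift a b (toℕ g))) (∑-inRange n a b b≤n)

dist-split : ∀ x y → dist x y ≡ (x ∸ y) + (y ∸ x)
dist-split zero    zero    = refl
dist-split zero    (suc y) = refl
dist-split (suc x) zero    = sym (+-identityʳ (suc x))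
dist-split (suc x) (suc y) = dist-split x y

-- Both sides equal max x y.
∸+-sym : ∀ x y → (x ∸ y) + y ≡ (y ∸ x) + x
∸+-sym x y with ≤-total x y
... | inj₁ x≤y = trans (cong (_+ y) (m≤n⇒m∸n≡0 x≤y)) (sym (m∸n+n≡m x≤y))
... | inj₂ y≤x = trans (m∸n+n≡m y≤x) (cong (_+ x) (sym (m≤n⇒m∸n≡0 y≤x)))

up down : ∀ {m} → S m → ℕ
up   {m} σ = ∑[ i < m ] (val σ i ∸ toℕ i)
down {m} σ = ∑[ i < m ] (toℕ i ∸ val σ i)

-- σ only rearranges the positions, so the upward and downward displacements balance.
up≡down : ∀ {m} (σ : S m) → up σ ≡ down σ
up≡down {m} σ = +-cancelʳ-≡ _ (up σ) (down σ) (begin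
  up σ + ∑[ i < m ] toℕ i                     ≡⟨ ∑-distrib-+ (λ i → val σ i ∸ toℕ i) toℕ ⟨
  ∑[ i < m ] ((val σ i ∸ toℕ i) + toℕ i)      ≡⟨ sum-cong-≗ {m} (λ i → ∸+-sym (val σ i) (toℕ i)) ⟩
  ∑[ i < m ] ((toℕ i ∸ val σ i) + val σ i)    ≡⟨ ∑-distrib-+ (λ i → toℕ i ∸ val σ i) (val σ) ⟩
  down σ + ∑[ i < m ] val σ i                 ≡⟨ cong (down σ +_) (∑-permute toℕ σ) ⟨
  down σ + ∑[ i < m ] toℕ i                   ∎)
  where open ≡-Reasoning

ℓ₁≡2*up : ∀ {m} (σ : S m) → ℓ₁ σ ≡ 2 * up σ
ℓ₁≡2*up {m} σ = begin
  List.sum (map h (allFin m))                  ≡⟨ cong List.sum (List.map-tabulate (λ i → i) h) ⟩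
  List.sum (tabulate h)                        ≡⟨ sum-tabulate h ⟩
  ∑[ i < m ] h i                               ≡⟨ sum-cong-≗ {m} (λ i → dist-split (val σ i) (toℕ i)) ⟩
  ∑[ i < m ] ((val σ i ∸ toℕ i) + (toℕ i ∸ val σ i))
                                               ≡⟨ ∑-distrib-+ (λ i → val σ i ∸ toℕ i) _ ⟩
  up σ + down σ                                ≡⟨ cong (up σ +_) (up≡down σ) ⟨
  up σ + up σ                                  ≡⟨ cong (up σ +_) (+-identityʳ (up σ)) ⟨
  2 * up σ                                     ∎
  where
  open ≡-Reasoning
  h : Fin m → ℕ
  h i = dist (val σ i) (toℕ i)

-- The number of positions i that σ moves upward across the gap between g and g + 1.
crossings : ∀ {m} → S m → Fin m → ℕ
crossings {m} σ g = ∑[ i < m ] inRange (toℕ i) (val σ i) (toℕ g)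

-- Counting the upward displacement gap by gap: position i contributes to the σ(i) ∸ i gaps
-- g with i ≤ g < σ(i); then exchange the two sums.
up≡∑crossings : ∀ {m} (σ : S m) → up σ ≡ ∑[ g < m ] crossings σ g
up≡∑crossings {m} σ = trans
  (sum-cong-≗ {m} (λ i → sym (∑-inRange m (toℕ i) (val σ i) (<⇒≤ (Fin.toℕ<n (σ ⟨$⟩ʳ i))))))
  (∑-comm {m} {m} (λ i g → inRange (toℕ i) (val σ i) (toℕ g)))

module Orbits {m} (σ : S m) where

  σ-injective : ∀ {x y} → σ ⟨$⟩ʳ x ≡ σ ⟨$⟩ʳ y → x ≡ y
  σ-injective {x} {y} σx≡σy = trans (sym (inverseˡ σ)) (trans (cong (σ ⟨$⟩ˡ_) σx≡σy) (inverseˡ σ))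

  iter-cancel : ∀ i j x → iter σ i x ≡ iter σ (i + j) x → x ≡ iter σ j x
  iter-cancel zero    j x eq = eq
  iter-cancel (suc i) j x eq = iter-cancel i j x (σ-injective eq)

  -- σ⁻¹(x) lies on the forward orbit of x, reached after fewer than m steps
  -- (pigeonhole on x, σ(x), …, σᵐ(x)).
  orbit : ∀ x → Σ ℕ λ q → q < m × iter σ q x ≡ σ ⟨$⟩ˡ x
  orbit x with Fin.pigeonhole (n<1+n m) (λ k → iter σ (toℕ k) x)
  ... | i , j , i<j , σⁱx≡σʲx with m≤n⇒∃[o]m+o≡n i<j
  ... | d , i+1+d≡j = d , d<m , sym σ⁻¹x≡σᵈx
    where
    x≡σσᵈx : x ≡ σ ⟨$⟩ʳ iter σ d x
    x≡σσᵈx = iter-cancel (toℕ i) (suc d) x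
      (trans σⁱx≡σʲx (cong (λ t → iter σ t x) (trans (sym i+1+d≡j) (sym (+-suc (toℕ i) d)))))
    σ⁻¹x≡σᵈx : σ ⟨$⟩ˡ x ≡ iter σ d x
    σ⁻¹x≡σᵈx = trans (cong (σ ⟨$⟩ˡ_) x≡σσᵈx) (inverseˡ σ)
    d<m : d < m
    d<m = ≤-pred (≤-trans (s≤s (≤-trans (s≤s (m≤n+m d (toℕ i))) (≤-reflexive i+1+d≡j))) (Fin.toℕ<n j))

  closed⇒closed⁻¹ : (P : Fin m → Set) → (∀ x → P x → P (σ ⟨$⟩ʳ x)) → ∀ x → P x → P (σ ⟨$⟩ˡ x)
  closed⇒closed⁻¹ P closed x Px with orbit x
  ... | q , _ , σ^qx≡σ⁻¹x = subst P σ^qx≡σ⁻¹x (iterate q)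
    where
    iterate : ∀ j → P (iter σ j x)
    iterate zero    = Px
    iterate (suc j) = closed _ (iterate j)

InWindow : ∀ {m} → ℕ → ℕ → Fin m → Set
InWindow off a x = off ≤ toℕ x × toℕ x < off + a

-- A window invariant under σ and σ⁻¹ carries a permutation ρ ∈ S_a: the restriction of σ
-- to the window, shifted down by off.
module Restriction {m} (σ : S m) (off a : ℕ) (fits : off + a ≤ m)
  (closed   : ∀ x → InWindow off a x → InWindow off a (σ ⟨$⟩ʳ x))
  (closed⁻¹ : ∀ x → InWindow off a x → InWindow off a (σ ⟨$⟩ˡ x)) where

  enter : Fin a → Fin m
  enter i = fromℕ< (≤-trans (+-monoʳ-< off (Fin.toℕ<n i)) fits)

  toℕ-enter : ∀ i → toℕ (enter i) ≡ off + toℕ i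
  toℕ-enter i = Fin.toℕ-fromℕ< _

  enter-inWindow : ∀ i → InWindow off a (enter i)
  enter-inWindow i rewrite toℕ-enter i = m≤m+n off (toℕ i) , +-monoʳ-< off (Fin.toℕ<n i)

  -- The window proof only enters an irrelevant argument, so leave x w does not depend on w.
  leave : (x : Fin m) → InWindow off a x → Fin a
  leave x w = fromℕ< (subst (toℕ x ∸ off <_) (m+n∸m≡n off a) (∸-monoˡ-< (proj₂ w) (proj₁ w)))

  leave-cong : ∀ {x y} → x ≡ y → (w : InWindow off a x) (w′ : InWindow off a y) → leave x w ≡ leave y w′
  leave-cong refl w w′ = refl

  off+leave : ∀ x (w : InWindow off a x) → off + toℕ (leave x w) ≡ toℕ x
  off+leave x w = trans (cong (off +_) (Fin.toℕ-fromℕ< _)) (m+[n∸m]≡n (proj₁ w))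

  leave-enter : ∀ i (w : InWindow off a (enter i)) → leave (enter i) w ≡ i
  leave-enter i w = Fin.toℕ-injective (+-cancelˡ-≡ off _ _ (trans (off+leave (enter i) w) (toℕ-enter i)))

  enter-leave : ∀ x (w : InWindow off a x) → enter (leave x w) ≡ x
  enter-leave x w = Fin.toℕ-injective (trans (toℕ-enter _) (off+leave x w))

  restrict : (f : Fin m → Fin m) → (∀ x → InWindow off a x → InWindow off a (f x)) → Fin a → Fin a
  restrict f f-closed i = leave (f (enter i)) (f-closed _ (enter-inWindow i))

  restrict-inverse : ∀ {f g} f-closed g-closed → (∀ x → f (g x) ≡ x) →
    ∀ i → restrict f f-closed (restrict g g-closed i) ≡ i
  restrict-inverse {f} {g} f-closed g-closed fg≡id i = begin
    leave (f (enter j)) (f-closed _ (enter-inWindow j))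
      ≡⟨ leave-cong (cong f (enter-leave _ g-in)) (f-closed _ (enter-inWindow j)) g∘f-in ⟩
    leave (f (g (enter i))) g∘f-in
      ≡⟨ leave-cong (fg≡id (enter i)) g∘f-in (enter-inWindow i) ⟩
    leave (enter i) (enter-inWindow i)
      ≡⟨ leave-enter i (enter-inWindow i) ⟩
    i ∎
    where
    open ≡-Reasoning
    g-in : InWindow off a (g (enter i))
    g-in = g-closed _ (enter-inWindow i)
    j : Fin a
    j = leave (g (enter i)) g-in
    g∘f-in : InWindow off a (f (g (enter i)))
    g∘f-in = f-closed _ g-in

  ρ : S a
  ρ = permutation (restrict (σ ⟨$⟩ʳ_) closed) (restrict (σ ⟨$⟩ˡ_) closed⁻¹)
        (restrict-inverse closed closed⁻¹ (λ _ → inverseʳ σ))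
        (restrict-inverse closed⁻¹ closed (λ _ → inverseˡ σ))

  ρ-spec : ∀ i x → toℕ x ≡ off + toℕ i → val σ x ≡ off + toℕ (ρ ⟨$⟩ʳ i)
  ρ-spec i x x≡off+i rewrite Fin.toℕ-injective (trans x≡off+i (sym (toℕ-enter i))) =
    sym (off+leave (σ ⟨$⟩ʳ enter i) (closed _ (enter-inWindow i)))

prefix-invariant⇒concat : ∀ {m} (σ : S m) a (a≤m : a ≤ m) → (∀ x → toℕ x < a → val σ x < a) →
  Σ (S a) λ π → Σ (S (m ∸ a)) λ τ → IsConcat (sym (m+[n∸m]≡n a≤m)) σ π τ
prefix-invariant⇒concat {m} σ a a≤m invariant =
  Prefix.ρ , Suffix.ρ ,
  (λ i → Prefix.ρ-spec i _ (trans (Fin.toℕ-cast _ _) (Fin.toℕ-↑ˡ i b))) ,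
  (λ j → Suffix.ρ-spec j _ (trans (Fin.toℕ-cast _ _) (Fin.toℕ-↑ʳ a j)))
  where
  open Orbits σ
  b = m ∸ a
  m≡a+b : m ≡ a + b
  m≡a+b = sym (m+[n∸m]≡n a≤m)

  invariant⁻¹ : ∀ x → toℕ x < a → toℕ (σ ⟨$⟩ˡ x) < a
  invariant⁻¹ = closed⇒closed⁻¹ (λ x → toℕ x < a) invariant

  -- The complementary segment is invariant as well, since σ and σ⁻¹ fix the prefix setwise.
  suffix-closed : ∀ x → InWindow a b x → InWindow a b (σ ⟨$⟩ʳ x)
  suffix-closed x (a≤x , _) with a ≤? val σ x
  ... | yes a≤σx = a≤σx , subst (val σ x <_) m≡a+b (Fin.toℕ<n (σ ⟨$⟩ʳ x))
  ... | no  a≰σx = contradiction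
        (subst (λ y → toℕ y < a) (inverseˡ σ) (invariant⁻¹ _ (≰⇒> a≰σx))) (≤⇒≯ a≤x)

  suffix-closed⁻¹ : ∀ x → InWindow a b x → InWindow a b (σ ⟨$⟩ˡ x)
  suffix-closed⁻¹ x (a≤x , _) with a ≤? toℕ (σ ⟨$⟩ˡ x)
  ... | yes a≤σ⁻¹x = a≤σ⁻¹x , subst (toℕ (σ ⟨$⟩ˡ x) <_) m≡a+b (Fin.toℕ<n (σ ⟨$⟩ˡ x))
  ... | no  a≰σ⁻¹x = contradiction
        (subst (λ y → toℕ y < a) (inverseʳ σ) (invariant _ (≰⇒> a≰σ⁻¹x))) (≤⇒≯ a≤x)

  module Prefix = Restriction σ 0 a a≤m
    (λ x (_ , x<a) → z≤n , invariant x x<a) (λ x (_ , x<a) → z≤n , invariant⁻¹ x x<a)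
  module Suffix = Restriction σ a b (≤-reflexive (sym m≡a+b)) suffix-closed suffix-closed⁻¹

gap-crossed : ∀ {m} (σ : S m) → Connected σ → ∀ g → suc g < m → Σ (Fin m) λ i → toℕ i ≤ g × g < val σ i
gap-crossed {m} σ connected g 1+g<m with Fin.any? (λ i → toℕ i ≤? g ×-dec g <? val σ i)
... | yes crossing = crossing
... | no  ¬crossing = ⊥-elim (connected
        (suc g , m ∸ suc g , s≤s z≤n , m<n⇒0<n∸m 1+g<m , sym (m+[n∸m]≡n 1+g≤m) ,
         prefix-invariant⇒concat σ (suc g) 1+g≤m invariant))
  where
  1+g≤m : suc g ≤ m
  1+g≤m = <⇒≤ 1+g<m

  invariant : ∀ x → toℕ x < suc g → val σ x < suc g
  invariant x x≤g with val σ x <? suc g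
  ... | yes σx≤g = σx≤g
  ... | no  σx≰g = contradiction (x , ≤-pred x≤g , ≮⇒≥ σx≰g) ¬crossing

module CycleLeader {m} (σ : S m) (1<m : 1 < m) {L : Fin m} (leader : IsCycleLeader σ L) where
  open Orbits σ

  orbit-above : ∀ q → q < m → toℕ L ≤ toℕ (iter σ q L)
  orbit-above q q<m = All.lookup (proj₂ leader) (∈-upTo⁺ q<m)

  L<σL : toℕ L < val σ L
  L<σL = ≤∧≢⇒< (orbit-above 1 1<m) (λ L≡σL → proj₁ leader (sym L≡σL))

  L<σ⁻¹L : toℕ L < toℕ (σ ⟨$⟩ˡ L)
  L<σ⁻¹L with orbit L
  ... | q , q<m , σ^qL≡σ⁻¹L = ≤∧≢⇒< (subst (λ y → toℕ L ≤ toℕ y) σ^qL≡σ⁻¹L (orbit-above q q<m))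
    (λ L≡σ⁻¹L → proj₁ leader (cong toℕ (trans (cong (σ ⟨$⟩ʳ_) (Fin.toℕ-injective L≡σ⁻¹L)) (inverseʳ σ))))

  L-crosses : inRange (toℕ L) (val σ L) (toℕ L) ≡ 1
  L-crosses = 𝟙-yes (toℕ L ≤? toℕ L ×-dec toℕ L <? val σ L) (≤-refl , L<σL)

  -- If L > 0, a second position crosses that gap: one crossing the gap just below L
  -- must land above L, because σ⁻¹(L) > L.
  two-crossings : Connected σ → ∀ g → toℕ L ≡ suc g → 2 ≤ crossings σ L
  two-crossings connected g L≡1+g with gap-crossed σ connected g (subst (_< m) L≡1+g (Fin.toℕ<n L))
  ... | i , i≤g , g<σi =
    subst (_≤ crossings σ L) (cong₂ _+_ L-crosses i-crosses) (two-terms≤∑ _ L≢i)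
    where
    i<L : toℕ i < toℕ L
    i<L = subst (toℕ i <_) (sym L≡1+g) (s≤s i≤g)
    σi≢L : val σ i ≢ toℕ L
    σi≢L σi≡L = <⇒≱ i<L (subst (λ y → toℕ L ≤ toℕ y) σ⁻¹L≡i (<⇒≤ L<σ⁻¹L))
      where
      σ⁻¹L≡i : σ ⟨$⟩ˡ L ≡ i
      σ⁻¹L≡i = trans (cong (σ ⟨$⟩ˡ_) (sym (Fin.toℕ-injective σi≡L))) (inverseˡ σ)
    L<σi : toℕ L < val σ i
    L<σi = ≤∧≢⇒< (subst (_≤ val σ i) (sym L≡1+g) g<σi) (λ L≡σi → σi≢L (sym L≡σi))
    i-crosses : inRange (toℕ i) (val σ i) (toℕ L) ≡ 1
    i-crosses = 𝟙-yes (toℕ i ≤? toℕ L ×-dec toℕ L <? val σ i) (<⇒≤ i<L , L<σi)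
    L≢i : L ≢ i
    L≢i L≡i = <⇒≢ i<L (cong toℕ (sym L≡i))

<pred⇒suc< : ∀ {g m} → g < pred m → suc g < m
<pred⇒suc< {m = suc m} g<m = s≤s g<m

-- The key local estimate at the gap just above g: a cycle leader there costs one crossing
-- beyond the one every inner gap of a connected permutation already has, except at g = 0.
module _ {m} (σ : S m) (connected : Connected σ) (1<m : 1 < m) where

  inner-gap-crossed : ∀ g → suc (toℕ g) < m → 1 ≤ crossings σ g
  inner-gap-crossed g 1+g<m with gap-crossed σ connected (toℕ g) 1+g<m
  ... | i , i≤g , g<σi = subst (_≤ crossings σ g)
    (𝟙-yes (toℕ i ≤? toℕ g ×-dec toℕ g <? val σ i) (i≤g , g<σi)) (term≤∑ _ i)

  -- At a leader the right-hand side of the estimate is at least 2: either L = 0, which is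
  -- crossed by L itself, or L > 0 and two positions cross the gap.
  leader-gap : ∀ L → IsCycleLeader σ L → 2 ≤ inRange 0 1 (toℕ L) + crossings σ L
  leader-gap zero    leader =
    s≤s (subst (_≤ crossings σ zero) L-crosses (term≤∑ (λ i → inRange (toℕ i) (val σ i) 0) zero))
    where open CycleLeader σ 1<m leader
  leader-gap (suc g) leader = CycleLeader.two-crossings σ 1<m leader connected (toℕ g) refl

  gap-bound : ∀ g →
    𝟙 (isCycleLeader? σ g) + inRange 0 (pred m) (toℕ g) ≤ inRange 0 1 (toℕ g) + crossings σ g
  gap-bound g = bound (isCycleLeader? σ g)
    where
    bound : (leader? : Dec (IsCycleLeader σ g)) →
      𝟙 leader? + inRange 0 (pred m) (toℕ g) ≤ inRange 0 1 (toℕ g) + crossings σ g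
    bound (yes leader) = ≤-trans (s≤s (𝟙-≤ (0 ≤? toℕ g ×-dec toℕ g <? pred m) (λ _ → ≤-refl)))
                                 (leader-gap g leader)
    bound (no _)       = 𝟙-≤ (0 ≤? toℕ g ×-dec toℕ g <? pred m)
      (λ (_ , g<pred-m) → ≤-trans (inner-gap-crossed g (<pred⇒suc< g<pred-m)) (m≤n+m _ _))

  cycles+gaps≤1+up : nontrivialCycles σ + pred m ≤ 1 + up σ
  cycles+gaps≤1+up = begin
    nontrivialCycles σ + pred m
      ≡⟨ cong₂ _+_ (length-filter-tabulate (isCycleLeader? σ) (λ g → g))
                   (sym (∑-inRange m 0 (pred m) pred[n]≤n)) ⟩
    ∑[ g < m ] 𝟙 (isCycleLeader? σ g) + ∑[ g < m ] inRange 0 (pred m) (toℕ g)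
      ≡⟨ ∑-distrib-+ (λ g → 𝟙 (isCycleLeader? σ g)) (λ g → inRange 0 (pred m) (toℕ g)) ⟨
    ∑[ g < m ] (𝟙 (isCycleLeader? σ g) + inRange 0 (pred m) (toℕ g))
      ≤⟨ ∑-mono-≤ gap-bound ⟩
    ∑[ g < m ] (inRange 0 1 (toℕ g) + crossings σ g)
      ≡⟨ ∑-distrib-+ (λ g → inRange 0 1 (toℕ g)) (crossings σ) ⟩
    ∑[ g < m ] inRange 0 1 (toℕ g) + ∑[ g < m ] crossings σ g
      ≡⟨ cong₂ _+_ (sym (∑-inRange m 0 1 (<⇒≤ 1<m))) (up≡∑crossings σ) ⟨
    1 + up σ ∎
    where open ≤-Reasoning

lemma5p4 : (m k : ℕ) → 2 ≤ m → 1 ≤ k → (σ : S m) → Connected σ → ℓ₁ σ ≡ 2 * k →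
    nontrivialCycles σ + m ≤ k + 2
lemma5p4 m k 1<m@(s≤s (s≤s _)) _ σ connected ℓ₁≡2k = begin
  nontrivialCycles σ + m            ≡⟨ +-suc (nontrivialCycles σ) (pred m) ⟩
  suc (nontrivialCycles σ + pred m) ≤⟨ s≤s (cycles+gaps≤1+up σ connected 1<m) ⟩
  2 + up σ                          ≡⟨ cong (2 +_) up≡k ⟩
  2 + k                             ≡⟨ +-comm 2 k ⟩
  k + 2                             ∎
  where
  open ≤-Reasoning
  up≡k : up σ ≡ k
  up≡k = *-cancelˡ-≡ (up σ) k 2 (trans (sym (ℓ₁≡2*up σ)) ℓ₁≡2k)
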